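{- Let $(\mathcal{R},1,*,0,+,\leq)$ be a preordered semiring. The following rules are derivable in the mixed fragment $\vdash_{\mathsf{MS}}$ of Mixed Graded/Linear logic: (i) ($\multimap_{GL}$) for all $r\in\mathcal{R}$: if $\delta_2\odot\Delta_2\vdash_{\mathsf{GS}} t:X$ and $\delta_1\odot\Delta_1;(\Gamma_1,y:B,\Gamma_2)\vdash_{\mathsf{MS}} l:C$, then $(\delta_1,r*\delta_2)\odot(\Delta_1,\Delta_2);(\Gamma_1,z:\mathsf{Grd}_r X\multimap B,\Gamma_2)\vdash_{\mathsf{MS}}[z\,(\mathsf{Grd}\ r\ t)/y]\,l:C$; (ii) ($\multimap_{GR}$) if $(\delta,r)\odot(\Delta,x:X);\Gamma\vdash_{\mathsf{MS}} l:B$, then $\delta\odot\Delta;\Gamma\vdash_{\mathsf{MS}}\lambda z.(\mathsf{let}\ \mathsf{Grd}\ r\ x=z\ \mathsf{in}\ l):\mathsf{Grd}_rX\multimap B$.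
   Context: Fix a preordered semiring $(\mathcal{R},1,*,0,+,\leq)$: a semiring with a preorder $\leq$ for which $*$ and $+$ are monotone. Graded formulas: $X,Y,Z::=\mathsf{J}\mid X\boxtimes Y\mid \mathsf{Lin}\,A$; linear formulas: $A,B,C::=\mathsf{I}\mid A\otimes B\mid A\multimap B\mid \mathsf{Grd}_r X$ ($r\in\mathcal{R}$). Graded terms $t::=x\mid \mathsf{j}\mid \mathsf{let}\ \mathsf{j}=t_1\ \mathsf{in}\ t_2\mid (t_1,t_2)\mid \mathsf{let}\ (x,y)=t_1\ \mathsf{in}\ t_2\mid \mathsf{Lin}\ l$; linear terms $l::=x\mid \mathsf{i}\mid \mathsf{let}\ \mathsf{i}=l_1\ \mathsf{in}\ l_2\mid (l_1,l_2)\mid \mathsf{let}\ (x,y)=l_1\ \mathsf{in}\ l_2\mid \lambda x.l\mid l_1\,l_2\mid \mathsf{Grd}\ r\ t\mid \mathsf{let}\ \mathsf{Grd}\ r\ x=l_1\ \mathsf{in}\ l_2\mid \mathsf{Unlin}\ z\mid \mathsf{let}\ \mathsf{j}=z\ \mathsf{in}\ l\mid \mathsf{let}\ (x,y)=z\ \mathsf{in}\ l$; $[s/x]u$ is substitution. A grade vector $\delta$ is a finite sequence over $\mathcal{R}$; $\Delta$ is a sequence of graded hypotheses $x:X$, $\Gamma$ a sequence of linear hypotheses $x:A$; $\delta\odot\Delta$ pairs $\delta$ and $\Delta$ of equal length. Commas denote concatenation (disjoint variables); $r*\delta$ is pointwise scalar multiplication, $\delta_1+\delta_2$ pointwise addition,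 $\delta_1\leq\delta_2$ pointwise order. The judgments $\delta\odot\Delta\vdash_{\mathsf{GS}}t:X$ and $\delta\odot\Delta;\Gamma\vdash_{\mathsf{MS}}l:A$ are defined mutually inductively by the rules (premises $\Rightarrow$ conclusion): GS: (id) $1\odot x:X\vdash x:X$. (unit$^{\mathsf J}_R$) $\emptyset\odot\emptyset\vdash \mathsf{j}:\mathsf{J}$. (unit$^{\mathsf J}_L$) $(\delta_1,\delta_2)\odot(\Delta_1,\Delta_2)\vdash t:X\Rightarrow(\delta_1,r,\delta_2)\odot(\Delta_1,x:\mathsf J,\Delta_2)\vdash \mathsf{let}\ \mathsf j=x\ \mathsf{in}\ t:X$. ($\boxtimes_R$) $\delta_1\odot\Delta_1\vdash t_1:X$, $\delta_2\odot\Delta_2\vdash t_2:Y\Rightarrow(\delta_1,\delta_2)\odot(\Delta_1,\Delta_2)\vdash(t_1,t_2):X\boxtimes Y$. ($\boxtimes_L$) $(\delta_1,r,r,\delta_2)\odot(\Delta_1,x:X,y:Y,\Delta_2)\vdash t:Z\Rightarrow(\delta_1,r,\delta_2)\odot(\Delta_1,z:X\boxtimes Y,\Delta_2)\vdash\mathsf{let}\ (x,y)=z\ \mathsf{in}\ t:Z$. ($\mathsf{Lin}_R$) $\delta\odot\Delta;\emptyset\vdash_{\mathsf{MS}}l:A\Rightarrow\delta\odot\Delta\vdash_{\mathsf{GS}}\mathsf{Lin}\ l:\mathsf{Lin}\,A$. (cut) $\delta_2\odot\Delta_2\vdash t_1:X$, $(\delta_1,r,\delta_3)\odot(\Delta_1,x:X,\Delta_3)\vdash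 t_2:Y\Rightarrow(\delta_1,r*\delta_2,\delta_3)\odot(\Delta_1,\Delta_2,\Delta_3)\vdash[t_1/x]t_2:Y$. (weak) $(\delta_1,\delta_2)\odot(\Delta_1,\Delta_2)\vdash t:Y\Rightarrow(\delta_1,0,\delta_2)\odot(\Delta_1,x:X,\Delta_2)\vdash t:Y$. (cont) $(\delta_1,r_1,r_2,\delta_2)\odot(\Delta_1,x:X,y:X,\Delta_2)\vdash t:Y\Rightarrow(\delta_1,r_1+r_2,\delta_2)\odot(\Delta_1,x:X,\Delta_2)\vdash[x/y]t:Y$. (ex) swapping two adjacent graded hypotheses together with their grades. (sub) $\delta_1\odot\Delta\vdash t:X$, $\delta_1\leq\delta_2\Rightarrow\delta_2\odot\Delta\vdash t:X$. MS: (id) $\emptyset\odot\emptyset;x:A\vdash x:A$. (unit$^{\mathsf I}_R$) $\emptyset\odot\emptyset;\emptyset\vdash\mathsf i:\mathsf I$. (unit$^{\mathsf I}_L$) $\delta\odot\Delta;(\Gamma_1,\Gamma_2)\vdash l:A\Rightarrow\delta\odot\Delta;(\Gamma_1,x:\mathsf I,\Gamma_2)\vdash\mathsf{let}\ \mathsf i=x\ \mathsf{in}\ l:A$. (unit$^{\mathsf J}$-MS) $(\delta_1,\delta_2)\odot(\Delta_1,\Delta_2);\Gamma\vdash l:A\Rightarrow(\delta_1,r,\delta_2)\odot(\Delta_1,x:\mathsf J,\Delta_2);\Gamma\vdash\mathsf{let}\ \mathsf j=x\ \mathsf{in}\ l:A$. ($\otimes_R$) $\delta_1\odot\Delta_1;\Gamma_1\vdash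 l_1:A$, $\delta_2\odot\Delta_2;\Gamma_2\vdash l_2:B\Rightarrow(\delta_1,\delta_2)\odot(\Delta_1,\Delta_2);(\Gamma_1,\Gamma_2)\vdash(l_1,l_2):A\otimes B$. ($\otimes_L$) $\delta\odot\Delta;(\Gamma_1,x:A,y:B,\Gamma_2)\vdash l:C\Rightarrow\delta\odot\Delta;(\Gamma_1,z:A\otimes B,\Gamma_2)\vdash\mathsf{let}\ (x,y)=z\ \mathsf{in}\ l:C$. ($\boxtimes$-MS) $(\delta_1,r,r,\delta_2)\odot(\Delta_1,x:X,y:Y,\Delta_2);\Gamma\vdash l:A\Rightarrow(\delta_1,r,\delta_2)\odot(\Delta_1,z:X\boxtimes Y,\Delta_2);\Gamma\vdash\mathsf{let}\ (x,y)=z\ \mathsf{in}\ l:A$. ($\multimap_R$) $\delta\odot\Delta;(\Gamma,x:A)\vdash l:B\Rightarrow\delta\odot\Delta;\Gamma\vdash\lambda x.l:A\multimap B$. ($\multimap_L$) $\delta_2\odot\Delta_2;\Gamma_2\vdash l_1:A$, $\delta_1\odot\Delta_1;(\Gamma_1,x:B,\Gamma_3)\vdash l_2:C\Rightarrow(\delta_1,\delta_2)\odot(\Delta_1,\Delta_2);(\Gamma_1,z:A\multimap B,\Gamma_2,\Gamma_3)\vdash[z\,l_1/x]l_2:C$. ($\mathsf{Grd}_R$) $\delta\odot\Delta\vdash_{\mathsf{GS}}t:X\Rightarrow(r*\delta)\odot\Delta;\emptyset\vdash_{\mathsf{MS}}\mathsf{Grd}\ r\ t:\mathsf{Grd}_r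 X$. ($\mathsf{Grd}_L$) $(\delta,r)\odot(\Delta,x:X);\Gamma\vdash l:A\Rightarrow\delta\odot\Delta;(z:\mathsf{Grd}_rX,\Gamma)\vdash\mathsf{let}\ \mathsf{Grd}\ r\ x=z\ \mathsf{in}\ l:A$. ($\mathsf{Lin}_L$) $\delta\odot\Delta;(x:A,\Gamma)\vdash l:B\Rightarrow(\delta,1)\odot(\Delta,z:\mathsf{Lin}\,A);\Gamma\vdash[\mathsf{Unlin}\ z/x]l:B$. (cut) $\delta_2\odot\Delta_2;\Gamma_2\vdash l_1:A$, $\delta_1\odot\Delta_1;(\Gamma_1,x:A,\Gamma_3)\vdash l_2:B\Rightarrow(\delta_1,\delta_2)\odot(\Delta_1,\Delta_2);(\Gamma_1,\Gamma_2,\Gamma_3)\vdash[l_1/x]l_2:B$. (gcut) $\delta_2\odot\Delta_2\vdash_{\mathsf{GS}}t:X$, $(\delta_1,r,\delta_3)\odot(\Delta_1,x:X,\Delta_3);\Gamma\vdash l:B\Rightarrow(\delta_1,r*\delta_2,\delta_3)\odot(\Delta_1,\Delta_2,\Delta_3);\Gamma\vdash[t/x]l:B$. (weak), (cont), (sub) as in GS acting on the graded context (linear context unchanged); (gex) swaps adjacent graded hypotheses with their grades; (ex) swaps adjacent linear hypotheses. -}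

module Defs where

open import Level using (Level; _⊔_; suc)
open import Algebra.Bundles using (Semiring)
open import Relation.Binary.Core using (Rel; _Preserves₂_⟶_⟶_)
open import Relation.Binary.Structures using (IsPreorder)
open import Data.Nat as ℕ using (ℕ)
open import Data.Bool using (Bool; true; false; if_then_else_; _∨_)
open import Data.Product using (_×_; _,_; proj₁)
open import Data.List as L using (List; []; _∷_)
open import Data.Vec as V using (Vec; []; _∷_)
open import Data.Vec.Relation.Binary.Pointwise.Inductive using (Pointwise)
open import Relation.Nullary.Decidable using (⌊_⌋)
open import Relation.Binary.PropositionalEquality using (_≢_)
import Data.Vec.Relation.Unary.All as VAll
import Data.List.Relation.Unary.All as LAll

record PreorderedSemiring (c ℓ₁ ℓ₂ : Level) : Set (Level.suc (c ⊔ ℓ₁ ⊔ ℓ₂)) where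
  field
    semiring : Semiring c ℓ₁
  open Semiring semiring public
  field
    _≤_        : Rel Carrier ℓ₂
    isPreorder : IsPreorder _≈_ _≤_
    +-mono-≤   : _+_ Preserves₂ _≤_ ⟶ _≤_ ⟶ _≤_
    *-mono-≤   : _*_ Preserves₂ _≤_ ⟶ _≤_ ⟶ _≤_

Var : Set
Var = ℕ

_==_ : Var → Var → Bool
x == y = ⌊ x ℕ.≟ y ⌋

module MGL {c ℓ₁ ℓ₂} (𝓡 : PreorderedSemiring c ℓ₁ ℓ₂) where

  open PreorderedSemiring 𝓡 using (Carrier; 1#; 0#; _≤_)
    renaming (_*_ to _*ʳ_; _+_ to _+ʳ_)

  infixr 6 _⊠_ _⊗_
  infixr 5 _⊸_

  mutual
    data GFml : Set c where
      J    : GFml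
      _⊠_  : GFml → GFml → GFml
      Lin  : LFml → GFml

    data LFml : Set c where
      I    : LFml
      _⊗_  : LFml → LFml → LFml
      _⊸_  : LFml → LFml → LFml
      Grd  : Carrier → GFml → LFml

  -- Graded terms t and linear terms l.
  --   gletpair x y t₁ t₂  is  let (x,y) = t₁ in t₂   (graded)
  --   lletpair x y l₁ l₂  is  let (x,y) = l₁ in l₂   (linear)
  --   letgrd r x l₁ l₂    is  let Grd r x = l₁ in l₂
  --   unlin t, letjL t l, gletpairL x y t l  are  Unlin z, let j = z in l,
  --   let (x,y) = z in l, with the graded variable z generalised to a
  --   graded term (so that the syntax is closed under substitution [t/z]).
  mutual
    data GTerm : Set c where
      gvar     : Var → GTerm
      jj       : GTerm
      letj     : GTerm → GTerm → GTerm
      gpair    : GTerm → GTerm → GTerm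
      gletpair : Var → Var → GTerm → GTerm → GTerm
      lin      : LTerm → GTerm

    data LTerm : Set c where
      lvar      : Var → LTerm
      ii        : LTerm
      leti      : LTerm → LTerm → LTerm
      lpair     : LTerm → LTerm → LTerm
      lletpair  : Var → Var → LTerm → LTerm → LTerm
      lam       : Var → LTerm → LTerm
      app       : LTerm → LTerm → LTerm
      grd       : Carrier → GTerm → LTerm
      letgrd    : Carrier → Var → LTerm → LTerm → LTerm
      unlin     : GTerm → LTerm
      letjL     : GTerm → LTerm → LTerm
      gletpairL : Var → Var → GTerm → LTerm → LTerm

  -- Substitution (a binder for the same name shadows; variable
  -- conventions of the paper make capture irrelevant).

  mutual
    gsubG : GTerm → Var → GTerm → GTerm
    gsubG s x (gvar y) = if x == y then s else gvar y
    gsubG s x jj = jj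
    gsubG s x (letj t₁ t₂) = letj (gsubG s x t₁) (gsubG s x t₂)
    gsubG s x (gpair t₁ t₂) = gpair (gsubG s x t₁) (gsubG s x t₂)
    gsubG s x (gletpair y₁ y₂ t₁ t₂) =
      gletpair y₁ y₂ (gsubG s x t₁)
        (if (x == y₁) ∨ (x == y₂) then t₂ else gsubG s x t₂)
    gsubG s x (lin l) = lin (gsubL s x l)

    gsubL : GTerm → Var → LTerm → LTerm
    gsubL s x (lvar y) = lvar y
    gsubL s x ii = ii
    gsubL s x (leti l₁ l₂) = leti (gsubL s x l₁) (gsubL s x l₂)
    gsubL s x (lpair l₁ l₂) = lpair (gsubL s x l₁) (gsubL s x l₂)
    gsubL s x (lletpair y₁ y₂ l₁ l₂) =
      lletpair y₁ y₂ (gsubL s x l₁)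
        (if (x == y₁) ∨ (x == y₂) then l₂ else gsubL s x l₂)
    gsubL s x (lam y l) = lam y (if x == y then l else gsubL s x l)
    gsubL s x (app l₁ l₂) = app (gsubL s x l₁) (gsubL s x l₂)
    gsubL s x (grd r t) = grd r (gsubG s x t)
    gsubL s x (letgrd r y l₁ l₂) =
      letgrd r y (gsubL s x l₁) (if x == y then l₂ else gsubL s x l₂)
    gsubL s x (unlin t) = unlin (gsubG s x t)
    gsubL s x (letjL t l) = letjL (gsubG s x t) (gsubL s x l)
    gsubL s x (gletpairL y₁ y₂ t l) =
      gletpairL y₁ y₂ (gsubG s x t)
        (if (x == y₁) ∨ (x == y₂) then l else gsubL s x l)

  mutual
    lsubG : LTerm → Var → GTerm → GTerm
    lsubG s x (gvar y) = gvar y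
    lsubG s x jj = jj
    lsubG s x (letj t₁ t₂) = letj (lsubG s x t₁) (lsubG s x t₂)
    lsubG s x (gpair t₁ t₂) = gpair (lsubG s x t₁) (lsubG s x t₂)
    lsubG s x (gletpair y₁ y₂ t₁ t₂) =
      gletpair y₁ y₂ (lsubG s x t₁)
        (if (x == y₁) ∨ (x == y₂) then t₂ else lsubG s x t₂)
    lsubG s x (lin l) = lin (lsubL s x l)

    lsubL : LTerm → Var → LTerm → LTerm
    lsubL s x (lvar y) = if x == y then s else lvar y
    lsubL s x ii = ii
    lsubL s x (leti l₁ l₂) = leti (lsubL s x l₁) (lsubL s x l₂)
    lsubL s x (lpair l₁ l₂) = lpair (lsubL s x l₁) (lsubL s x l₂)
    lsubL s x (lletpair y₁ y₂ l₁ l₂) =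
      lletpair y₁ y₂ (lsubL s x l₁)
        (if (x == y₁) ∨ (x == y₂) then l₂ else lsubL s x l₂)
    lsubL s x (lam y l) = lam y (if x == y then l else lsubL s x l)
    lsubL s x (app l₁ l₂) = app (lsubL s x l₁) (lsubL s x l₂)
    lsubL s x (grd r t) = grd r (lsubG s x t)
    lsubL s x (letgrd r y l₁ l₂) =
      letgrd r y (lsubL s x l₁) (if x == y then l₂ else lsubL s x l₂)
    lsubL s x (unlin t) = unlin (lsubG s x t)
    lsubL s x (letjL t l) = letjL (lsubG s x t) (lsubL s x l)
    lsubL s x (gletpairL y₁ y₂ t l) =
      gletpairL y₁ y₂ (lsubG s x t)
        (if (x == y₁) ∨ (x == y₂) then l else lsubL s x l)

  -- Contexts.  A graded context δ ⊙ Δ is a grade vector δ and a sequence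
  -- of graded hypotheses Δ of the same length n (enforced by Vec).
  GHyp : Set c
  GHyp = Var × GFml

  LHyp : Set c
  LHyp = Var × LFml

  Grades : ℕ → Set c
  Grades n = Vec Carrier n

  GCtx : ℕ → Set c
  GCtx n = Vec GHyp n

  LCtx : Set c
  LCtx = List LHyp

  _⊛_ : ∀ {n} → Carrier → Grades n → Grades n
  r ⊛ δ = V.map (r *ʳ_) δ

  _≤v_ : ∀ {n} → Grades n → Grades n → Set (c ⊔ ℓ₂)
  δ₁ ≤v δ₂ = Pointwise _≤_ δ₁ δ₂

  open V using (_++_)
  open L using () renaming (_++_ to _++ₗ_)

  mutual
    data GS : ∀ {n} → Grades n → GCtx n → GTerm → GFml → Set (c ⊔ ℓ₂) where
      id   : ∀ {x X} → GS (1# ∷ []) ((x , X) ∷ []) (gvar x) X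
      unitJR : GS [] [] jj J
      unitJL : ∀ {m k} {δ₁ : Grades m} {δ₂ : Grades k} {Δ₁ Δ₂ t X r x}
             → GS (δ₁ ++ δ₂) (Δ₁ ++ Δ₂) t X
             → GS (δ₁ ++ r ∷ δ₂) (Δ₁ ++ (x , J) ∷ Δ₂) (letj (gvar x) t) X
      ⊠R   : ∀ {m k} {δ₁ : Grades m} {δ₂ : Grades k} {Δ₁ Δ₂ t₁ t₂ X Y}
             → GS δ₁ Δ₁ t₁ X → GS δ₂ Δ₂ t₂ Y
             → GS (δ₁ ++ δ₂) (Δ₁ ++ Δ₂) (gpair t₁ t₂) (X ⊠ Y)
      ⊠L   : ∀ {m k} {δ₁ : Grades m} {δ₂ : Grades k} {Δ₁ Δ₂ t X Y Z r x y z}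
             → GS (δ₁ ++ r ∷ r ∷ δ₂) (Δ₁ ++ (x , X) ∷ (y , Y) ∷ Δ₂) t Z
             → GS (δ₁ ++ r ∷ δ₂) (Δ₁ ++ (z , X ⊠ Y) ∷ Δ₂) (gletpair x y (gvar z) t) Z
      LinR : ∀ {n} {δ : Grades n} {Δ l A}
             → MS δ Δ [] l A
             → GS δ Δ (lin l) (Lin A)
      cut  : ∀ {m k p} {δ₁ : Grades m} {δ₂ : Grades k} {δ₃ : Grades p}
               {Δ₁ Δ₂ Δ₃ t₁ t₂ X Y r x}
             → GS δ₂ Δ₂ t₁ X
             → GS (δ₁ ++ r ∷ δ₃) (Δ₁ ++ (x , X) ∷ Δ₃) t₂ Y
             → GS (δ₁ ++ (r ⊛ δ₂) ++ δ₃) (Δ₁ ++ Δ₂ ++ Δ₃) (gsubG t₁ x t₂) Y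
      weak : ∀ {m k} {δ₁ : Grades m} {δ₂ : Grades k} {Δ₁ Δ₂ t X Y x}
             → GS (δ₁ ++ δ₂) (Δ₁ ++ Δ₂) t Y
             → GS (δ₁ ++ 0# ∷ δ₂) (Δ₁ ++ (x , X) ∷ Δ₂) t Y
      cont : ∀ {m k} {δ₁ : Grades m} {δ₂ : Grades k} {Δ₁ Δ₂ t X Y r₁ r₂ x y}
             → GS (δ₁ ++ r₁ ∷ r₂ ∷ δ₂) (Δ₁ ++ (x , X) ∷ (y , X) ∷ Δ₂) t Y
             → GS (δ₁ ++ (r₁ +ʳ r₂) ∷ δ₂) (Δ₁ ++ (x , X) ∷ Δ₂) (gsubG (gvar x) y t) Y
      ex   : ∀ {m k} {δ₁ : Grades m} {δ₂ : Grades k} {Δ₁ Δ₂ t Y r₁ r₂ h₁ h₂}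
             → GS (δ₁ ++ r₁ ∷ r₂ ∷ δ₂) (Δ₁ ++ h₁ ∷ h₂ ∷ Δ₂) t Y
             → GS (δ₁ ++ r₂ ∷ r₁ ∷ δ₂) (Δ₁ ++ h₂ ∷ h₁ ∷ Δ₂) t Y
      sub  : ∀ {n} {δ₁ δ₂ : Grades n} {Δ t X}
             → GS δ₁ Δ t X → δ₁ ≤v δ₂
             → GS δ₂ Δ t X

    data MS : ∀ {n} → Grades n → GCtx n → LCtx → LTerm → LFml → Set (c ⊔ ℓ₂) where
      id     : ∀ {x A} → MS [] [] ((x , A) ∷ []) (lvar x) A
      unitIR : MS [] [] [] ii I
      unitIL : ∀ {n} {δ : Grades n} {Δ Γ₁ Γ₂ l A x}
             → MS δ Δ (Γ₁ ++ₗ Γ₂) l A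
             → MS δ Δ (Γ₁ ++ₗ (x , I) ∷ Γ₂) (leti (lvar x) l) A
      unitJ  : ∀ {m k} {δ₁ : Grades m} {δ₂ : Grades k} {Δ₁ Δ₂ Γ l A r x}
             → MS (δ₁ ++ δ₂) (Δ₁ ++ Δ₂) Γ l A
             → MS (δ₁ ++ r ∷ δ₂) (Δ₁ ++ (x , J) ∷ Δ₂) Γ (letjL (gvar x) l) A
      ⊗R     : ∀ {m k} {δ₁ : Grades m} {δ₂ : Grades k} {Δ₁ Δ₂ Γ₁ Γ₂ l₁ l₂ A B}
             → MS δ₁ Δ₁ Γ₁ l₁ A → MS δ₂ Δ₂ Γ₂ l₂ B
             → MS (δ₁ ++ δ₂) (Δ₁ ++ Δ₂) (Γ₁ ++ₗ Γ₂) (lpair l₁ l₂) (A ⊗ B)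
      ⊗L     : ∀ {n} {δ : Grades n} {Δ Γ₁ Γ₂ l A B C x y z}
             → MS δ Δ (Γ₁ ++ₗ (x , A) ∷ (y , B) ∷ Γ₂) l C
             → MS δ Δ (Γ₁ ++ₗ (z , A ⊗ B) ∷ Γ₂) (lletpair x y (lvar z) l) C
      ⊠MS    : ∀ {m k} {δ₁ : Grades m} {δ₂ : Grades k} {Δ₁ Δ₂ Γ l X Y A r x y z}
             → MS (δ₁ ++ r ∷ r ∷ δ₂) (Δ₁ ++ (x , X) ∷ (y , Y) ∷ Δ₂) Γ l A
             → MS (δ₁ ++ r ∷ δ₂) (Δ₁ ++ (z , X ⊠ Y) ∷ Δ₂) Γ (gletpairL x y (gvar z) l) A
      ⊸R     : ∀ {n} {δ : Grades n} {Δ Γ l A B x}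
             → MS δ Δ (Γ ++ₗ (x , A) ∷ []) l B
             → MS δ Δ Γ (lam x l) (A ⊸ B)
      ⊸L     : ∀ {m k} {δ₁ : Grades m} {δ₂ : Grades k}
                 {Δ₁ Δ₂ Γ₁ Γ₂ Γ₃ l₁ l₂ A B C x z}
             → MS δ₂ Δ₂ Γ₂ l₁ A
             → MS δ₁ Δ₁ (Γ₁ ++ₗ (x , B) ∷ Γ₃) l₂ C
             → MS (δ₁ ++ δ₂) (Δ₁ ++ Δ₂) (Γ₁ ++ₗ (z , A ⊸ B) ∷ Γ₂ ++ₗ Γ₃)
                  (lsubL (app (lvar z) l₁) x l₂) C
      GrdR   : ∀ {n} {δ : Grades n} {Δ t X r}
             → GS δ Δ t X
             → MS (r ⊛ δ) Δ [] (grd r t) (Grd r X)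
      GrdL   : ∀ {n} {δ : Grades n} {Δ Γ l A X r x z}
             → MS (δ ++ r ∷ []) (Δ ++ (x , X) ∷ []) Γ l A
             → MS δ Δ ((z , Grd r X) ∷ Γ) (letgrd r x (lvar z) l) A
      LinL   : ∀ {n} {δ : Grades n} {Δ Γ l A B x z}
             → MS δ Δ ((x , A) ∷ Γ) l B
             → MS (δ ++ 1# ∷ []) (Δ ++ (z , Lin A) ∷ []) Γ (lsubL (unlin (gvar z)) x l) B
      cut    : ∀ {m k} {δ₁ : Grades m} {δ₂ : Grades k}
                 {Δ₁ Δ₂ Γ₁ Γ₂ Γ₃ l₁ l₂ A B x}
             → MS δ₂ Δ₂ Γ₂ l₁ A
             → MS δ₁ Δ₁ (Γ₁ ++ₗ (x , A) ∷ Γ₃) l₂ B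
             → MS (δ₁ ++ δ₂) (Δ₁ ++ Δ₂) (Γ₁ ++ₗ Γ₂ ++ₗ Γ₃) (lsubL l₁ x l₂) B
      gcut   : ∀ {m k p} {δ₁ : Grades m} {δ₂ : Grades k} {δ₃ : Grades p}
                 {Δ₁ Δ₂ Δ₃ Γ t l X B r x}
             → GS δ₂ Δ₂ t X
             → MS (δ₁ ++ r ∷ δ₃) (Δ₁ ++ (x , X) ∷ Δ₃) Γ l B
             → MS (δ₁ ++ (r ⊛ δ₂) ++ δ₃) (Δ₁ ++ Δ₂ ++ Δ₃) Γ (gsubL t x l) B
      weak   : ∀ {m k} {δ₁ : Grades m} {δ₂ : Grades k} {Δ₁ Δ₂ Γ l X B x}
             → MS (δ₁ ++ δ₂) (Δ₁ ++ Δ₂) Γ l B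
             → MS (δ₁ ++ 0# ∷ δ₂) (Δ₁ ++ (x , X) ∷ Δ₂) Γ l B
      cont   : ∀ {m k} {δ₁ : Grades m} {δ₂ : Grades k} {Δ₁ Δ₂ Γ l X B r₁ r₂ x y}
             → MS (δ₁ ++ r₁ ∷ r₂ ∷ δ₂) (Δ₁ ++ (x , X) ∷ (y , X) ∷ Δ₂) Γ l B
             → MS (δ₁ ++ (r₁ +ʳ r₂) ∷ δ₂) (Δ₁ ++ (x , X) ∷ Δ₂) Γ (gsubL (gvar x) y l) B
      gex    : ∀ {m k} {δ₁ : Grades m} {δ₂ : Grades k} {Δ₁ Δ₂ Γ l B r₁ r₂ h₁ h₂}
             → MS (δ₁ ++ r₁ ∷ r₂ ∷ δ₂) (Δ₁ ++ h₁ ∷ h₂ ∷ Δ₂) Γ l B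
             → MS (δ₁ ++ r₂ ∷ r₁ ∷ δ₂) (Δ₁ ++ h₂ ∷ h₁ ∷ Δ₂) Γ l B
      ex     : ∀ {n} {δ : Grades n} {Δ Γ₁ Γ₂ l B h₁ h₂}
             → MS δ Δ (Γ₁ ++ₗ h₁ ∷ h₂ ∷ Γ₂) l B
             → MS δ Δ (Γ₁ ++ₗ h₂ ∷ h₁ ∷ Γ₂) l B
      sub    : ∀ {n} {δ₁ δ₂ : Grades n} {Δ Γ l B}
             → MS δ₁ Δ Γ l B → δ₁ ≤v δ₂
             → MS δ₂ Δ Γ l B

  FreshG : ∀ {n} → Var → GCtx n → Set c
  FreshG z Δ = VAll.All (λ h → z ≢ proj₁ h) Δ

  FreshL : Var → LCtx → Set c
  FreshL z Γ = LAll.All (λ h → z ≢ proj₁ h) Γ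

{-# OPTIONS --safe #-}
-- Both rules are composites of primitive rules: ⊸_GL is ⊸L applied to the
-- Grd_R-derivation of  Grd r t, and ⊸_GR is Grd_L followed by ⊸R, after the
-- Grd_r X hypothesis that Grd_L introduces at the front of the linear context
-- has been moved to its end by exchanges.
module Submission where

open import Defs
open import Data.Product using (_×_; _,_)
open import Data.List using (_∷_; [])
open import Data.Vec using (_∷_; [])
open import Data.List.Properties using (++-assoc)
open import Relation.Binary.PropositionalEquality using (_≢_; _≡_; subst; sym)
import Data.List as L
import Data.Vec as V

module _ {c ℓ₁ ℓ₂} (𝓡 : PreorderedSemiring c ℓ₁ ℓ₂) where
  open MGL 𝓡
  open PreorderedSemiring 𝓡 using (Carrier)

  ex-toEnd : ∀ {n} {δ : Grades n} {Δ : GCtx n} {l : LTerm} {B : LFml}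
             {h : LHyp} (Γ₁ Γ₂ : LCtx) →
             MS δ Δ (Γ₁ L.++ h ∷ Γ₂) l B → MS δ Δ (Γ₁ L.++ Γ₂ L.++ h ∷ []) l B
  ex-toEnd Γ₁ []       d = d
  ex-toEnd {δ = δ} {Δ} {l} {B} {h} Γ₁ (g ∷ Γ₂) d =
    reassoc (++-assoc Γ₁ (g ∷ []) (Γ₂ L.++ h ∷ []))
      (ex-toEnd (Γ₁ L.++ g ∷ []) Γ₂
        (reassoc (sym (++-assoc Γ₁ (g ∷ []) (h ∷ Γ₂))) (ex {Γ₁ = Γ₁} d)))
    where
    reassoc : ∀ {Γ Γ′} → Γ ≡ Γ′ → MS δ Δ Γ l B → MS δ Δ Γ′ l B
    reassoc = subst (λ Γ → MS δ Δ Γ l B)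

  ⊸GL : ∀ {m k} (r : Carrier)
        {δ₁ : Grades m} {Δ₁ : GCtx m} {δ₂ : Grades k} {Δ₂ : GCtx k}
        {Γ₁ Γ₂ : LCtx} {t : GTerm} {l : LTerm} {X : GFml} {B C : LFml}
        {y z : Var} →
        GS δ₂ Δ₂ t X →
        MS δ₁ Δ₁ (Γ₁ L.++ (y , B) ∷ Γ₂) l C →
        MS (δ₁ V.++ (r ⊛ δ₂)) (Δ₁ V.++ Δ₂) (Γ₁ L.++ (z , (Grd r X ⊸ B)) ∷ Γ₂)
           (lsubL (app (lvar z) (grd r t)) y l) C
  ⊸GL r ⊢t ⊢l = ⊸L {Γ₂ = []} (GrdR ⊢t) ⊢l

  ⊸GR : ∀ {n} {δ : Grades n} {Δ : GCtx n} {r : Carrier}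
        {Γ : LCtx} {l : LTerm} {X : GFml} {B : LFml} {x z : Var} →
        MS (δ V.++ r ∷ []) (Δ V.++ (x , X) ∷ []) Γ l B →
        MS δ Δ Γ (lam z (letgrd r x (lvar z) l)) (Grd r X ⊸ B)
  ⊸GR ⊢l = ⊸R (ex-toEnd [] _ (GrdL ⊢l))

lemma4 : ∀ {c ℓ₁ ℓ₂} (𝓡 : PreorderedSemiring c ℓ₁ ℓ₂) →
    let open MGL 𝓡 in
    -- (i) the rule ⊸_GL
    (∀ {m k} (r : PreorderedSemiring.Carrier 𝓡)
       {δ₁ : Grades m} {Δ₁ : GCtx m} {δ₂ : Grades k} {Δ₂ : GCtx k}
       {Γ₁ Γ₂ : LCtx} {t : GTerm} {l : LTerm} {X : GFml} {B C : LFml}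
       {y z : Var} →
       FreshG z Δ₁ → FreshG z Δ₂ → FreshL z Γ₁ → FreshL z Γ₂ →
       GS δ₂ Δ₂ t X →
       MS δ₁ Δ₁ (Γ₁ L.++ (y , B) ∷ Γ₂) l C →
       MS (δ₁ V.++ (r ⊛ δ₂)) (Δ₁ V.++ Δ₂) (Γ₁ L.++ (z , (Grd r X ⊸ B)) ∷ Γ₂)
          (lsubL (app (lvar z) (grd r t)) y l) C)
    ×
    -- (ii) the rule ⊸_GR
    (∀ {n} {δ : Grades n} {Δ : GCtx n} {r : PreorderedSemiring.Carrier 𝓡}
       {Γ : LCtx} {l : LTerm} {X : GFml} {B : LFml} {x z : Var} →
       FreshG z Δ → FreshL z Γ → z ≢ x →
       MS (δ V.++ r ∷ []) (Δ V.++ (x , X) ∷ []) Γ l B →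
       MS δ Δ Γ (lam z (letgrd r x (lvar z) l)) (Grd r X ⊸ B))
lemma4 𝓡 = (λ r _ _ _ _ → ⊸GL 𝓡 r)
         , (λ _ _ _ → ⊸GR 𝓡)
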